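{- Let $\mathcal L$ be a first-order language, and let $M^a$, and for a first-order $\mathcal L$-theory $T$ the theory $T^a$, be as defined in the context. (i) For every first-order formula $A(\vec u)$ of $\mathcal L$ with all free variables indicated, $M^a\vdash^i\forall\vec x\,[A(\vec x)\leftrightarrow P_{A(\vec u)}(\vec x)]$, where $\vdash^i$ denotes intuitionistic first-order deducibility. (ii) As classical theories, $T^a$ is conservative over $T$: for every $\mathcal L$-sentence $B$, $T\vdash^c B$ iff $T^a\vdash^c B$.
   Context: For each first-order $\mathcal L$-formula $A(u_1,\dots,u_n)$ (all free variables indicated) add two new $n$-ary relation symbols $P_{A(\vec u)}$, $N_{A(\vec u)}$; the resulting language is $\mathcal L^a$. Writing $\forall\vec x(A_1\rightleftarrows A_2)$ for the two formulae $\forall\vec x(A_1\to A_2)$ and $\forall\vec x(A_2\to A_1)$, the theory $M^a$ has axioms: $\forall\vec x\,\neg(P_{A(\vec u)}(\vec x)\wedge N_{A(\vec u)}(\vec x))$; $\forall\vec x\,(P_{A(\vec u)}(\vec x)\vee N_{A(\vec u)}(\vec x))$; for atomic $A$: $\forall\vec x(P_{A(\vec u)}(\vec x)\rightleftarrows A(\vec x))$; for $A=B\wedge C$: $\forall\vec x(P_A(\vec x)\rightleftarrows P_B(\vec x)\wedge P_C(\vec x))$; for $A=B\vee C$: $\forall\vec x(P_A(\vec x)\rightleftarrows P_B(\vec x)\vee P_C(\vec x))$; for $A=\neg B$: $\forall\vec x(P_A(\vec x)\rightleftarrows N_B(\vec x))$; for $A=B\to C$: $\forall\vec x(P_A(\vec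 x)\rightleftarrows N_B(\vec x)\vee P_C(\vec x))$; for $A=\exists yB(\vec u,y)$: $\forall\vec x(P_A(\vec x)\rightleftarrows\exists y\,P_{B(\vec u,v)}(\vec x,y))$; for $A=\forall yB(\vec u,y)$: $\forall\vec x(N_A(\vec x)\rightleftarrows\exists y\,N_{B(\vec u,v)}(\vec x,y))$. For a first-order $\mathcal L$-theory $T$, $T^a$ is $M^a$ plus the axioms $\forall\vec x\,P_{A(\vec u)}(\vec x)$ for every axiom $\forall\vec x\,A(\vec x)$ of $T$. -}

module Defs where

open import Data.Nat using (ℕ; zero; suc)
open import Data.Fin using (Fin; zero; suc)
open import Data.Vec using (Vec; []; _∷_; tabulate)
open import Data.List using (List; []; _∷_; map)
open import Data.List.Membership.Propositional using (_∈_)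
open import Data.Product using (Σ; _×_; _,_)
open import Data.Sum using (_⊎_; inj₁; inj₂)
open import Data.Bool using (Bool; true; false)
open import Relation.Binary.PropositionalEquality using (_≡_)

-- First-order languages (function and relation symbols with arities).
-- Equality is not a logical primitive.

record Language : Set₁ where
  constructor language
  field
    Fun  : Set
    fari : Fun → ℕ
    Rel  : Set
    rari : Rel → ℕ
open Language public

data Tm (F : Set) (ar : F → ℕ) (n : ℕ) : Set where
  var : Fin n → Tm F ar n
  fun : (f : F) → Vec (Tm F ar n) (ar f) → Tm F ar n

Term : Language → ℕ → Set
Term L = Tm (Fun L) (fari L)

module _ {F : Set} {ar : F → ℕ} where
  mutual
    tsubst : ∀ {n m} → (Fin n → Tm F ar m) → Tm F ar n → Tm F ar m
    tsubst σ (var i)    = σ i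
    tsubst σ (fun f ts) = fun f (tsubsts σ ts)

    tsubsts : ∀ {n m k} → (Fin n → Tm F ar m) → Vec (Tm F ar n) k → Vec (Tm F ar m) k
    tsubsts σ []       = []
    tsubsts σ (t ∷ ts) = tsubst σ t ∷ tsubsts σ ts

-- Formulas, scoped: a formula  A : Formula L n  is  A(u₀,…,u_{n-1})
-- with all free variables indicated.  Quantifiers bind variable zero.

infixr 6 _∧ᶠ_
infixr 5 _∨ᶠ_
infixr 4 _⇒ᶠ_

data Formula (L : Language) (n : ℕ) : Set where
  atom  : (R : Rel L) → Vec (Term L n) (rari L R) → Formula L n
  _∧ᶠ_  : Formula L n → Formula L n → Formula L n
  _∨ᶠ_  : Formula L n → Formula L n → Formula L n
  _⇒ᶠ_  : Formula L n → Formula L n → Formula L n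
  ¬ᶠ_   : Formula L n → Formula L n
  ∃ᶠ    : Formula L (suc n) → Formula L n
  ∀ᶠ    : Formula L (suc n) → Formula L n

Sentence : Language → Set
Sentence L = Formula L 0

lift : ∀ {L : Language} {n m} → (Fin n → Term L m) → Fin (suc n) → Term L (suc m)
lift {L} σ zero    = var zero
lift {L} σ (suc i) = tsubst {ar = fari L} (λ j → var (suc j)) (σ i)

fsubst : ∀ {L n m} → (Fin n → Term L m) → Formula L n → Formula L m
fsubst σ (atom R ts) = atom R (tsubsts σ ts)
fsubst σ (A ∧ᶠ B)    = fsubst σ A ∧ᶠ fsubst σ B
fsubst σ (A ∨ᶠ B)    = fsubst σ A ∨ᶠ fsubst σ B
fsubst σ (A ⇒ᶠ B)    = fsubst σ A ⇒ᶠ fsubst σ B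
fsubst σ (¬ᶠ A)      = ¬ᶠ fsubst σ A
fsubst {L} σ (∃ᶠ A)  = ∃ᶠ (fsubst (lift {L} σ) A)
fsubst {L} σ (∀ᶠ A)  = ∀ᶠ (fsubst (lift {L} σ) A)

wk : ∀ {L n} → Formula L n → Formula L (suc n)
wk = fsubst (λ i → var (suc i))

wk₀ : ∀ {L} m → Sentence L → Formula L m
wk₀ m = fsubst (λ ())

inst : ∀ {L n} → Formula L (suc n) → Term L n → Formula L n
inst A t = fsubst (λ { zero → t ; (suc i) → var i }) A

close : ∀ {L n} → Formula L n → Sentence L
close {n = zero}  A = A
close {n = suc n} A = close (∀ᶠ A)

vars : ∀ {L} n → Vec (Term L n) n
vars n = tabulate var

data Logic : Set where
  intuitionistic classical : Logic

data Deriv {L : Language} (lg : Logic) (Ax : Sentence L → Set)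
     : {n : ℕ} → List (Formula L n) → Formula L n → Set where
  ax   : ∀ {n Γ φ} → Ax φ → Deriv lg Ax {n} Γ (wk₀ n φ)
  hyp  : ∀ {n Γ A} → A ∈ Γ → Deriv lg Ax {n} Γ A
  ∧I   : ∀ {n Γ A B} → Deriv lg Ax {n} Γ A → Deriv lg Ax Γ B → Deriv lg Ax Γ (A ∧ᶠ B)
  ∧E₁  : ∀ {n Γ A B} → Deriv lg Ax {n} Γ (A ∧ᶠ B) → Deriv lg Ax Γ A
  ∧E₂  : ∀ {n Γ A B} → Deriv lg Ax {n} Γ (A ∧ᶠ B) → Deriv lg Ax Γ B
  ∨I₁  : ∀ {n Γ A B} → Deriv lg Ax {n} Γ A → Deriv lg Ax Γ (A ∨ᶠ B)
  ∨I₂  : ∀ {n Γ A B} → Deriv lg Ax {n} Γ B → Deriv lg Ax Γ (A ∨ᶠ B)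
  ∨E   : ∀ {n Γ A B C} → Deriv lg Ax {n} Γ (A ∨ᶠ B) →
         Deriv lg Ax (A ∷ Γ) C → Deriv lg Ax (B ∷ Γ) C → Deriv lg Ax Γ C
  ⇒I   : ∀ {n Γ A B} → Deriv lg Ax {n} (A ∷ Γ) B → Deriv lg Ax Γ (A ⇒ᶠ B)
  ⇒E   : ∀ {n Γ A B} → Deriv lg Ax {n} Γ (A ⇒ᶠ B) → Deriv lg Ax Γ A → Deriv lg Ax Γ B
  ¬I   : ∀ {n Γ A B} → Deriv lg Ax {n} (A ∷ Γ) B → Deriv lg Ax (A ∷ Γ) (¬ᶠ B) →
         Deriv lg Ax Γ (¬ᶠ A)
  ¬E   : ∀ {n Γ A B} → Deriv lg Ax {n} Γ A → Deriv lg Ax Γ (¬ᶠ A) → Deriv lg Ax Γ B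
  ∀I   : ∀ {n Γ A} → Deriv lg Ax {suc n} (map wk Γ) A → Deriv lg Ax {n} Γ (∀ᶠ A)
  ∀E   : ∀ {n Γ A} → Deriv lg Ax {n} Γ (∀ᶠ A) → (t : Term L n) → Deriv lg Ax Γ (inst A t)
  ∃I   : ∀ {n Γ A} (t : Term L n) → Deriv lg Ax {n} Γ (inst A t) → Deriv lg Ax Γ (∃ᶠ A)
  ∃E   : ∀ {n Γ A C} → Deriv lg Ax {n} Γ (∃ᶠ A) →
         Deriv lg Ax {suc n} (A ∷ map wk Γ) (wk C) → Deriv lg Ax Γ C
  lem  : ∀ {n Γ A} → lg ≡ classical → Deriv lg Ax {n} Γ (A ∨ᶠ ¬ᶠ A)

-- Ax ⊢ φ for a sentence φ: derivable from no hypotheses, possibly using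
-- finitely many extra free variables (standard first-order logic,
-- nonempty domains).
_⊢⟨_⟩_ : ∀ {L} → (Sentence L → Set) → Logic → Sentence L → Set
Ax ⊢⟨ lg ⟩ φ = Σ ℕ λ m → Deriv lg Ax [] (wk₀ m φ)

-- The extended language 𝓛ᵃ: new n-ary symbols P_{A(u⃗)} (tag true)
-- and N_{A(u⃗)} (tag false) for each A : Formula L n.

LA : Language → Language
LA L = language (Fun L) (fari L)
                (Rel L ⊎ (Bool × Σ ℕ (Formula L)))
                (λ { (inj₁ R) → rari L R ; (inj₂ (_ , n , _)) → n })

ι : ∀ {L n} → Formula L n → Formula (LA L) n
ι (atom R ts) = atom (inj₁ R) ts
ι (A ∧ᶠ B)    = ι A ∧ᶠ ι B
ι (A ∨ᶠ B)    = ι A ∨ᶠ ι B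
ι (A ⇒ᶠ B)    = ι A ⇒ᶠ ι B
ι (¬ᶠ A)      = ¬ᶠ ι A
ι (∃ᶠ A)      = ∃ᶠ (ι A)
ι (∀ᶠ A)      = ∀ᶠ (ι A)

Pᶠ : ∀ {L n} → Formula L n → Formula (LA L) n
Pᶠ {L} {n} A = atom (inj₂ (true , n , A)) (vars {LA L} n)

Nᶠ : ∀ {L n} → Formula L n → Formula (LA L) n
Nᶠ {L} {n} A = atom (inj₂ (false , n , A)) (vars {LA L} n)

-- The pairs (φ , ψ) for which  ∀x⃗(φ ⇄ ψ)  is an axiom of Mᵃ.
-- In the quantifier clauses, P_{B(u⃗,v)}(x⃗,y) is written in scope
-- suc n with y = variable zero (the one bound by ∃ᶠ/∀ᶠ).
data MaBicond {L : Language} : {n : ℕ} → Formula (LA L) n → Formula (LA L) n → Set where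
  c-atom : ∀ {n} R (ts : Vec (Term L n) (rari L R)) →
           MaBicond (Pᶠ (atom R ts)) (ι (atom R ts))
  c-and  : ∀ {n} (B C : Formula L n) → MaBicond (Pᶠ (B ∧ᶠ C)) (Pᶠ B ∧ᶠ Pᶠ C)
  c-or   : ∀ {n} (B C : Formula L n) → MaBicond (Pᶠ (B ∨ᶠ C)) (Pᶠ B ∨ᶠ Pᶠ C)
  c-not  : ∀ {n} (B : Formula L n) → MaBicond (Pᶠ (¬ᶠ B)) (Nᶠ B)
  c-imp  : ∀ {n} (B C : Formula L n) → MaBicond (Pᶠ (B ⇒ᶠ C)) (Nᶠ B ∨ᶠ Pᶠ C)
  c-ex   : ∀ {n} (B : Formula L (suc n)) → MaBicond (Pᶠ (∃ᶠ B)) (∃ᶠ (Pᶠ B))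
  c-all  : ∀ {n} (B : Formula L (suc n)) → MaBicond (Nᶠ (∀ᶠ B)) (∃ᶠ (Nᶠ B))

data MaAx {L : Language} : Sentence (LA L) → Set where
  excl  : ∀ {n} (A : Formula L n) → MaAx (close (¬ᶠ (Pᶠ A ∧ᶠ Nᶠ A)))
  total : ∀ {n} (A : Formula L n) → MaAx (close (Pᶠ A ∨ᶠ Nᶠ A))
  fwd   : ∀ {n} {φ ψ : Formula (LA L) n} → MaBicond φ ψ → MaAx (close (φ ⇒ᶠ ψ))
  bwd   : ∀ {n} {φ ψ : Formula (LA L) n} → MaBicond φ ψ → MaAx (close (ψ ⇒ᶠ φ))

-- A theory T is given by its axioms ∀x⃗ A(x⃗): T n A  means that the
-- universal closure of A : Formula L n is an axiom.
Theory : Language → Set₁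
Theory L = (n : ℕ) → Formula L n → Set

data TAx {L : Language} (T : Theory L) : Sentence L → Set where
  tax : ∀ {n} {A : Formula L n} → T n A → TAx T (close A)

data TaAx {L : Language} (T : Theory L) : Sentence (LA L) → Set where
  ma  : ∀ {φ} → MaAx φ → TaAx T φ
  tpa : ∀ {n} {A : Formula L n} → T n A → TaAx T (close (Pᶠ A))

-- For (i), ι A ⇒ P_A and P_A ⇒ ι A are proved by a simultaneous induction on A, for
-- every substitution instance and in every context so that the induction passes under
-- quantifiers. Where A itself would need classical reasoning (⇒, ¬, ∀), the axioms
-- P_B ∨ N_B and ¬(P_B ∧ N_B) take its place.
--
-- For (ii), by (i) every axiom ∀x⃗ A of T follows in Tᵃ from ∀x⃗ P_A, so ι carries
-- T-derivations to Tᵃ-derivations. Conversely, reading P_A(t⃗) as A(t⃗) and N_A(t⃗) as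
-- ¬A(t⃗) carries Tᵃ-derivations back to T-derivations: the axioms ∀x⃗ P_A become the
-- axioms of T, and those of Mᵃ become classical tautologies (totality turns into excluded
-- middle, the ∀-clause into ¬∀yB ↔ ∃y¬B). This is the only use of classical logic.

module Submission where

open import Defs
open import Data.Nat using (ℕ; zero; suc)
open import Data.Fin using (Fin; zero; suc)
open import Data.Vec using (Vec; []; _∷_; lookup)
open import Data.Vec.Properties using (lookup∘tabulate)
open import Data.List using (List; []; _∷_; map)
open import Data.List.Membership.Propositional.Properties using (∈-map⁺)
open import Data.List.Relation.Unary.Any using (here; there)
open import Data.Product using (_×_; _,_; proj₁; proj₂)
open import Data.Sum using (inj₁; inj₂)
open import Data.Bool using (true; false)
open import Function.Bundles using (_⇔_; mk⇔)
open import Relation.Binary.PropositionalEquality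
  using (_≡_; refl; sym; trans; cong; cong₂; subst; subst₂)

module _ {F : Set} {ar : F → ℕ} where

  shift : ∀ {n} → Fin n → Tm F ar (suc n)
  shift i = var (suc i)

  mutual
    tsubst-∘ : ∀ {n m k} {σ : Fin m → Tm F ar k} {τ : Fin n → Tm F ar m}
               {ρ : Fin n → Tm F ar k} → (∀ i → tsubst σ (τ i) ≡ ρ i) →
               ∀ t → tsubst σ (tsubst τ t) ≡ tsubst ρ t
    tsubst-∘ e (var i)    = e i
    tsubst-∘ e (fun f ts) = cong (fun f) (tsubsts-∘ e ts)

    tsubsts-∘ : ∀ {n m k j} {σ : Fin m → Tm F ar k} {τ : Fin n → Tm F ar m}
                {ρ : Fin n → Tm F ar k} → (∀ i → tsubst σ (τ i) ≡ ρ i) →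
                (ts : Vec (Tm F ar n) j) → tsubsts σ (tsubsts τ ts) ≡ tsubsts ρ ts
    tsubsts-∘ e []       = refl
    tsubsts-∘ e (t ∷ ts) = cong₂ _∷_ (tsubst-∘ e t) (tsubsts-∘ e ts)

  mutual
    tsubst-var : ∀ {n} {σ : Fin n → Tm F ar n} → (∀ i → σ i ≡ var i) →
                 ∀ t → tsubst σ t ≡ t
    tsubst-var e (var i)    = e i
    tsubst-var e (fun f ts) = cong (fun f) (tsubsts-var e ts)

    tsubsts-var : ∀ {n k} {σ : Fin n → Tm F ar n} → (∀ i → σ i ≡ var i) →
                  (ts : Vec (Tm F ar n) k) → tsubsts σ ts ≡ ts
    tsubsts-var e []       = refl
    tsubsts-var e (t ∷ ts) = cong₂ _∷_ (tsubst-var e t) (tsubsts-var e ts)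

  tsubst-shift-cancel : ∀ {n} {σ : Fin (suc n) → Tm F ar n} → (∀ i → σ (suc i) ≡ var i) →
                        ∀ t → tsubst σ (tsubst shift t) ≡ t
  tsubst-shift-cancel e t = trans (tsubst-∘ e t) (tsubst-var (λ _ → refl) t)

  lookup-tsubsts : ∀ {n m k} (σ : Fin n → Tm F ar m) (ts : Vec (Tm F ar n) k) i →
                   lookup (tsubsts σ ts) i ≡ tsubst σ (lookup ts i)
  lookup-tsubsts σ (t ∷ ts) zero    = refl
  lookup-tsubsts σ (t ∷ ts) (suc i) = lookup-tsubsts σ ts i

module _ {L : Language} where

  wkₛ : ∀ {k n} → (Fin k → Term L n) → Fin k → Term L (suc n)
  wkₛ σ i = tsubst shift (σ i)

  lift-∘ : ∀ {n m k} {σ : Fin m → Term L k} {τ : Fin n → Term L m} {ρ : Fin n → Term L k} →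
           (∀ i → tsubst σ (τ i) ≡ ρ i) →
           ∀ i → tsubst (lift {L} σ) (lift {L} τ i) ≡ lift {L} ρ i
  lift-∘ e zero    = refl
  lift-∘ {τ = τ} e (suc i) =
    trans (tsubst-∘ (λ _ → refl) (τ i))
          (trans (sym (tsubst-∘ (λ _ → refl) (τ i))) (cong (tsubst shift) (e i)))

  fsubst-∘ : ∀ {n m k} {σ : Fin m → Term L k} {τ : Fin n → Term L m} {ρ : Fin n → Term L k} →
             (∀ i → tsubst σ (τ i) ≡ ρ i) → ∀ A → fsubst σ (fsubst τ A) ≡ fsubst ρ A
  fsubst-∘ e (atom R ts) = cong (atom R) (tsubsts-∘ e ts)
  fsubst-∘ e (A ∧ᶠ B)    = cong₂ _∧ᶠ_ (fsubst-∘ e A) (fsubst-∘ e B)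
  fsubst-∘ e (A ∨ᶠ B)    = cong₂ _∨ᶠ_ (fsubst-∘ e A) (fsubst-∘ e B)
  fsubst-∘ e (A ⇒ᶠ B)    = cong₂ _⇒ᶠ_ (fsubst-∘ e A) (fsubst-∘ e B)
  fsubst-∘ e (¬ᶠ A)      = cong ¬ᶠ_ (fsubst-∘ e A)
  fsubst-∘ e (∃ᶠ A)      = cong ∃ᶠ (fsubst-∘ (lift-∘ e) A)
  fsubst-∘ e (∀ᶠ A)      = cong ∀ᶠ (fsubst-∘ (lift-∘ e) A)

  lift-var : ∀ {n} {σ : Fin n → Term L n} → (∀ i → σ i ≡ var i) →
             ∀ i → lift {L} σ i ≡ var i
  lift-var e zero    = refl
  lift-var e (suc i) = cong (tsubst shift) (e i)

  fsubst-var : ∀ {n} {σ : Fin n → Term L n} → (∀ i → σ i ≡ var i) →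
               ∀ A → fsubst σ A ≡ A
  fsubst-var e (atom R ts) = cong (atom R) (tsubsts-var e ts)
  fsubst-var e (A ∧ᶠ B)    = cong₂ _∧ᶠ_ (fsubst-var e A) (fsubst-var e B)
  fsubst-var e (A ∨ᶠ B)    = cong₂ _∨ᶠ_ (fsubst-var e A) (fsubst-var e B)
  fsubst-var e (A ⇒ᶠ B)    = cong₂ _⇒ᶠ_ (fsubst-var e A) (fsubst-var e B)
  fsubst-var e (¬ᶠ A)      = cong ¬ᶠ_ (fsubst-var e A)
  fsubst-var e (∃ᶠ A)      = cong ∃ᶠ (fsubst-var (lift-var e) A)
  fsubst-var e (∀ᶠ A)      = cong ∀ᶠ (fsubst-var (lift-var e) A)

  fsubst-cong : ∀ {n m} {σ ρ : Fin n → Term L m} → (∀ i → σ i ≡ ρ i) →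
                ∀ A → fsubst σ A ≡ fsubst ρ A
  fsubst-cong e A = trans (cong (fsubst _) (sym (fsubst-var (λ _ → refl) A))) (fsubst-∘ e A)

  wk-fsubst : ∀ {n m} (σ : Fin n → Term L m) (A : Formula L n) →
              wk (fsubst σ A) ≡ fsubst (wkₛ σ) A
  wk-fsubst σ A = fsubst-∘ (λ _ → refl) A

  inst-lift-wkₛ : ∀ {n m} (σ : Fin n → Term L m) (A : Formula L (suc n)) →
                  inst (fsubst (lift {L} (wkₛ σ)) A) (var zero) ≡ fsubst (lift {L} σ) A
  inst-lift-wkₛ σ A =
    fsubst-∘ (λ { zero → refl ; (suc i) → tsubst-shift-cancel (λ _ → refl) (wkₛ σ i) }) A

  inst-lift-shift : ∀ {n} (A : Formula L (suc n)) → inst (fsubst (lift {L} shift) A) (var zero) ≡ A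
  inst-lift-shift A = trans (inst-lift-wkₛ var A) (fsubst-var (lift-var (λ _ → refl)) A)

module Derivations {L : Language} {lg : Logic} {Ax : Sentence L → Set} where

  Derivable : ∀ {k} → Formula L k → Set
  Derivable {k} χ =
    ∀ {n} (Γ : List (Formula L n)) (σ : Fin k → Term L n) → Deriv lg Ax Γ (fsubst σ χ)

  close-elim : ∀ {k n} {Γ : List (Formula L n)} (χ : Formula L k) (σ : Fin k → Term L n) →
               Deriv lg Ax Γ (wk₀ n (close χ)) → Deriv lg Ax Γ (fsubst σ χ)
  close-elim {zero}  χ σ d = subst (Deriv lg Ax _) (fsubst-cong (λ ()) χ) d
  close-elim {suc k} χ σ d =
    subst (Deriv lg Ax _)
          (fsubst-∘ (λ { zero    → refl
                       ; (suc i) → tsubst-shift-cancel (λ _ → refl) (σ (suc i)) }) χ)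
          (∀E (close-elim (∀ᶠ χ) (λ i → σ (suc i)) d) (σ zero))

  close-intro : ∀ {k} {χ : Formula L k} → Derivable χ →
                ∀ {n} (Γ : List (Formula L n)) → Deriv lg Ax Γ (wk₀ n (close χ))
  close-intro {zero}  {χ} H Γ = subst (Deriv lg Ax Γ) (fsubst-cong (λ ()) χ) (H Γ (λ ()))
  close-intro {suc k}     H Γ = close-intro (λ Δ σ → ∀I (H (map wk Δ) (lift {L} σ))) Γ

  axiom-derivable : ∀ {k} {χ : Formula L k} → Ax (close χ) → Derivable χ
  axiom-derivable {χ = χ} a Γ σ = close-elim χ σ (ax a)

  hyp₀ : ∀ {n} {Γ : List (Formula L n)} {A} → Deriv lg Ax (A ∷ Γ) A
  hyp₀ = hyp (here refl)

  hyp₁ : ∀ {n} {Γ : List (Formula L n)} {A B} → Deriv lg Ax (B ∷ A ∷ Γ) A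
  hyp₁ = hyp (there (here refl))

  hyp₂ : ∀ {n} {Γ : List (Formula L n)} {A B C} → Deriv lg Ax (C ∷ B ∷ A ∷ Γ) A
  hyp₂ = hyp (there (there (here refl)))

module Pᶠ-Equivalence {L : Language} {lg : Logic} {Ax : Sentence (LA L) → Set}
                      (Ma⊆Ax : ∀ {φ} → MaAx φ → Ax φ) where
  open Derivations {LA L} {lg} {Ax}

  bicond⇒ : ∀ {k} {φ ψ : Formula (LA L) k} → MaBicond φ ψ → Derivable (φ ⇒ᶠ ψ)
  bicond⇒ b = axiom-derivable (Ma⊆Ax (fwd b))

  bicond⇐ : ∀ {k} {φ ψ : Formula (LA L) k} → MaBicond φ ψ → Derivable (ψ ⇒ᶠ φ)
  bicond⇐ b = axiom-derivable (Ma⊆Ax (bwd b))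

  Pᶠ∧Nᶠ-excluded : ∀ {k} (A : Formula L k) → Derivable (¬ᶠ (Pᶠ A ∧ᶠ Nᶠ A))
  Pᶠ∧Nᶠ-excluded A = axiom-derivable (Ma⊆Ax (excl A))

  Pᶠ∨Nᶠ : ∀ {k} (A : Formula L k) → Derivable (Pᶠ A ∨ᶠ Nᶠ A)
  Pᶠ∨Nᶠ A = axiom-derivable (Ma⊆Ax (total A))

  mutual
    ι⇒Pᶠ : ∀ {k} (A : Formula L k) → Derivable (ι A ⇒ᶠ Pᶠ A)
    ι⇒Pᶠ (atom R ts) Γ σ = bicond⇐ (c-atom R ts) Γ σ
    ι⇒Pᶠ (B ∧ᶠ C) Γ σ = ⇒I (⇒E (bicond⇐ (c-and B C) _ σ)
      (∧I (⇒E (ι⇒Pᶠ B _ σ) (∧E₁ hyp₀)) (⇒E (ι⇒Pᶠ C _ σ) (∧E₂ hyp₀))))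
    ι⇒Pᶠ (B ∨ᶠ C) Γ σ = ⇒I (⇒E (bicond⇐ (c-or B C) _ σ)
      (∨E hyp₀ (∨I₁ (⇒E (ι⇒Pᶠ B _ σ) hyp₀)) (∨I₂ (⇒E (ι⇒Pᶠ C _ σ) hyp₀))))
    ι⇒Pᶠ (B ⇒ᶠ C) Γ σ = ⇒I (⇒E (bicond⇐ (c-imp B C) _ σ) (∨E (Pᶠ∨Nᶠ B _ σ)
      (∨I₂ (⇒E (ι⇒Pᶠ C _ σ) (⇒E hyp₁ (⇒E (Pᶠ⇒ι B _ σ) hyp₀))))
      (∨I₁ hyp₀)))
    ι⇒Pᶠ (¬ᶠ B) Γ σ = ⇒I (∨E (Pᶠ∨Nᶠ B _ σ)
      (¬E (⇒E (Pᶠ⇒ι B _ σ) hyp₀) hyp₁)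
      (⇒E (bicond⇐ (c-not B) _ σ) hyp₀))
    ι⇒Pᶠ (∃ᶠ B) Γ σ = ⇒I (∃E hyp₀
      (subst (Deriv lg Ax _) (sym (wk-fsubst σ (Pᶠ (∃ᶠ B))))
        (⇒E (bicond⇐ (c-ex B) _ (wkₛ {LA L} σ))
          (∃I (var zero) (subst (Deriv lg Ax _) (sym (inst-lift-wkₛ σ (Pᶠ B)))
            (⇒E (ι⇒Pᶠ B _ (lift {LA L} σ)) hyp₀))))))
    -- If N_{∀B} held, some N_B(y) would; but B(y) gives P_B(y), contradicting exclusion.
    ι⇒Pᶠ (∀ᶠ B) Γ σ = ⇒I (∨E (Pᶠ∨Nᶠ (∀ᶠ B) _ σ) hyp₀
      (∃E (⇒E (bicond⇒ (c-all B) _ σ) hyp₀)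
        (¬E (∧I (⇒E (ι⇒Pᶠ B _ (lift {LA L} σ))
                    (subst (Deriv lg Ax _) (inst-lift-shift _) (∀E hyp₂ (var zero))))
                hyp₀)
            (Pᶠ∧Nᶠ-excluded B _ (lift {LA L} σ)))))

    Pᶠ⇒ι : ∀ {k} (A : Formula L k) → Derivable (Pᶠ A ⇒ᶠ ι A)
    Pᶠ⇒ι (atom R ts) Γ σ = bicond⇒ (c-atom R ts) Γ σ
    Pᶠ⇒ι (B ∧ᶠ C) Γ σ = ⇒I (∧I
      (⇒E (Pᶠ⇒ι B _ σ) (∧E₁ (⇒E (bicond⇒ (c-and B C) _ σ) hyp₀)))
      (⇒E (Pᶠ⇒ι C _ σ) (∧E₂ (⇒E (bicond⇒ (c-and B C) _ σ) hyp₀))))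
    Pᶠ⇒ι (B ∨ᶠ C) Γ σ = ⇒I (∨E (⇒E (bicond⇒ (c-or B C) _ σ) hyp₀)
      (∨I₁ (⇒E (Pᶠ⇒ι B _ σ) hyp₀)) (∨I₂ (⇒E (Pᶠ⇒ι C _ σ) hyp₀)))
    Pᶠ⇒ι (B ⇒ᶠ C) Γ σ = ⇒I (⇒I (∨E (⇒E (bicond⇒ (c-imp B C) _ σ) hyp₁)
      (¬E (∧I (⇒E (ι⇒Pᶠ B _ σ) hyp₁) hyp₀) (Pᶠ∧Nᶠ-excluded B _ σ))
      (⇒E (Pᶠ⇒ι C _ σ) hyp₀)))
    Pᶠ⇒ι (¬ᶠ B) Γ σ = ⇒I (¬I
      (∧I (⇒E (ι⇒Pᶠ B _ σ) hyp₀) (⇒E (bicond⇒ (c-not B) _ σ) hyp₁))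
      (Pᶠ∧Nᶠ-excluded B _ σ))
    Pᶠ⇒ι (∃ᶠ B) Γ σ = ⇒I (∃E (⇒E (bicond⇒ (c-ex B) _ σ) hyp₀)
      (∃I (var zero) (subst (Deriv lg Ax _) (sym (inst-lift-shift _))
        (⇒E (Pᶠ⇒ι B _ (lift {LA L} σ)) hyp₀))))
    Pᶠ⇒ι (∀ᶠ B) Γ σ = ⇒I (∀I (∨E (Pᶠ∨Nᶠ B _ (lift {LA L} σ))
      (⇒E (Pᶠ⇒ι B _ (lift {LA L} σ)) hyp₀)
      (¬E (∧I (subst (Deriv lg Ax _) (wk-fsubst σ (Pᶠ (∀ᶠ B))) hyp₁)
              (⇒E (bicond⇐ (c-all B) _ (wkₛ {LA L} σ))
                (∃I (var zero) (subst (Deriv lg Ax _) (sym (inst-lift-wkₛ σ (Nᶠ B))) hyp₀))))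
          (Pᶠ∧Nᶠ-excluded (∀ᶠ B) _ (wkₛ {LA L} σ)))))

module Relabel {F : Set} {ar : F → ℕ} {R₁ R₂ : Set} {r₁ : R₁ → ℕ} {r₂ : R₂ → ℕ}
  (at : ∀ {n} (R : R₁) → Vec (Tm F ar n) (r₁ R) → Formula (language F ar R₂ r₂) n)
  (at-tsubsts : ∀ {n m} (σ : Fin n → Tm F ar m) R ts → at R (tsubsts σ ts) ≡ fsubst σ (at R ts))
  where
  private
    L₁ L₂ : Language
    L₁ = language F ar R₁ r₁
    L₂ = language F ar R₂ r₂

  translate : ∀ {n} → Formula L₁ n → Formula L₂ n
  translate (atom R ts) = at R ts
  translate (A ∧ᶠ B)    = translate A ∧ᶠ translate B
  translate (A ∨ᶠ B)    = translate A ∨ᶠ translate B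
  translate (A ⇒ᶠ B)    = translate A ⇒ᶠ translate B
  translate (¬ᶠ A)      = ¬ᶠ translate A
  translate (∃ᶠ A)      = ∃ᶠ (translate A)
  translate (∀ᶠ A)      = ∀ᶠ (translate A)

  lift-relabel : ∀ {n m} (σ : Fin n → Tm F ar m) i → lift {L₁} σ i ≡ lift {L₂} σ i
  lift-relabel σ zero    = refl
  lift-relabel σ (suc i) = refl

  translate-fsubst : ∀ {n m} (σ : Fin n → Tm F ar m) (A : Formula L₁ n) →
                     translate (fsubst σ A) ≡ fsubst σ (translate A)
  translate-fsubst σ (atom R ts) = at-tsubsts σ R ts
  translate-fsubst σ (A ∧ᶠ B) = cong₂ _∧ᶠ_ (translate-fsubst σ A) (translate-fsubst σ B)
  translate-fsubst σ (A ∨ᶠ B) = cong₂ _∨ᶠ_ (translate-fsubst σ A) (translate-fsubst σ B)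
  translate-fsubst σ (A ⇒ᶠ B) = cong₂ _⇒ᶠ_ (translate-fsubst σ A) (translate-fsubst σ B)
  translate-fsubst σ (¬ᶠ A)   = cong ¬ᶠ_ (translate-fsubst σ A)
  translate-fsubst σ (∃ᶠ A)   =
    cong ∃ᶠ (trans (translate-fsubst (lift {L₁} σ) A) (fsubst-cong (lift-relabel σ) (translate A)))
  translate-fsubst σ (∀ᶠ A)   =
    cong ∀ᶠ (trans (translate-fsubst (lift {L₁} σ) A) (fsubst-cong (lift-relabel σ) (translate A)))

  translate-wk : ∀ {n} (A : Formula L₁ n) → translate (wk A) ≡ wk (translate A)
  translate-wk = translate-fsubst shift

  translate-wk₀ : ∀ n (φ : Sentence L₁) → translate (wk₀ n φ) ≡ wk₀ n (translate φ)
  translate-wk₀ n φ = trans (translate-fsubst _ φ) (fsubst-cong (λ ()) (translate φ))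

  translate-inst : ∀ {n} (A : Formula L₁ (suc n)) t → translate (inst A t) ≡ inst (translate A) t
  translate-inst A t =
    trans (translate-fsubst _ A) (fsubst-cong (λ { zero → refl ; (suc i) → refl }) (translate A))

  translate-close : ∀ {n} (A : Formula L₁ n) → translate (close A) ≡ close (translate A)
  translate-close {zero}  A = refl
  translate-close {suc n} A = translate-close (∀ᶠ A)

  map-translate-wk : ∀ {n} (Γ : List (Formula L₁ n)) →
                     map translate (map wk Γ) ≡ map wk (map translate Γ)
  map-translate-wk []      = refl
  map-translate-wk (A ∷ Γ) = cong₂ _∷_ (translate-wk A) (map-translate-wk Γ)

  module _ {lg : Logic} {Ax₁ : Sentence L₁ → Set} {Ax₂ : Sentence L₂ → Set}
           (translate-axiom : ∀ {φ} → Ax₁ φ →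
              ∀ {n} (Γ : List (Formula L₂ n)) → Deriv lg Ax₂ Γ (wk₀ n (translate φ))) where

    translate-deriv : ∀ {n} {Γ : List (Formula L₁ n)} {φ} →
                      Deriv lg Ax₁ Γ φ → Deriv lg Ax₂ (map translate Γ) (translate φ)
    translate-deriv {n} {Γ} (ax {φ = φ} a) =
      subst (Deriv lg Ax₂ _) (sym (translate-wk₀ n φ)) (translate-axiom a (map translate Γ))
    translate-deriv (hyp p)    = hyp (∈-map⁺ translate p)
    translate-deriv (∧I d e)   = ∧I (translate-deriv d) (translate-deriv e)
    translate-deriv (∧E₁ d)    = ∧E₁ (translate-deriv d)
    translate-deriv (∧E₂ d)    = ∧E₂ (translate-deriv d)
    translate-deriv (∨I₁ d)    = ∨I₁ (translate-deriv d)
    translate-deriv (∨I₂ d)    = ∨I₂ (translate-deriv d)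
    translate-deriv (∨E d e f) = ∨E (translate-deriv d) (translate-deriv e) (translate-deriv f)
    translate-deriv (⇒I d)     = ⇒I (translate-deriv d)
    translate-deriv (⇒E d e)   = ⇒E (translate-deriv d) (translate-deriv e)
    translate-deriv (¬I d e)   = ¬I (translate-deriv d) (translate-deriv e)
    translate-deriv (¬E d e)   = ¬E (translate-deriv d) (translate-deriv e)
    translate-deriv {Γ = Γ} (∀I d) =
      ∀I (subst (λ Δ → Deriv lg Ax₂ Δ _) (map-translate-wk Γ) (translate-deriv d))
    translate-deriv (∀E {A = A} d t) =
      subst (Deriv lg Ax₂ _) (sym (translate-inst A t)) (∀E (translate-deriv d) t)
    translate-deriv (∃I {A = A} t d) =
      ∃I t (subst (Deriv lg Ax₂ _) (translate-inst A t) (translate-deriv d))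
    translate-deriv {Γ = Γ} (∃E {A = A} {C} d e) =
      ∃E (translate-deriv d)
         (subst₂ (λ Δ X → Deriv lg Ax₂ (translate A ∷ Δ) X) (map-translate-wk Γ) (translate-wk C)
                 (translate-deriv e))
    translate-deriv (lem eq)   = lem eq

module Embedding (L : Language) where
  open Relabel {Fun L} {fari L} {Rel L} {Rel (LA L)} {rari L} {rari (LA L)}
               (λ R ts → atom (inj₁ R) ts) (λ σ R ts → refl) public

  ι-translate : ∀ {n} (A : Formula L n) → ι A ≡ translate A
  ι-translate (atom R ts) = refl
  ι-translate (A ∧ᶠ B)    = cong₂ _∧ᶠ_ (ι-translate A) (ι-translate B)
  ι-translate (A ∨ᶠ B)    = cong₂ _∨ᶠ_ (ι-translate A) (ι-translate B)
  ι-translate (A ⇒ᶠ B)    = cong₂ _⇒ᶠ_ (ι-translate A) (ι-translate B)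
  ι-translate (¬ᶠ A)      = cong ¬ᶠ_ (ι-translate A)
  ι-translate (∃ᶠ A)      = cong ∃ᶠ (ι-translate A)
  ι-translate (∀ᶠ A)      = cong ∀ᶠ (ι-translate A)

module Unfolding (L : Language) where

  unfoldAtom : ∀ {n} (R : Rel (LA L)) → Vec (Term L n) (rari (LA L) R) → Formula L n
  unfoldAtom (inj₁ R)               ts = atom R ts
  unfoldAtom (inj₂ (true  , k , A)) ts = fsubst (lookup ts) A
  unfoldAtom (inj₂ (false , k , A)) ts = ¬ᶠ fsubst (lookup ts) A

  unfoldAtom-tsubsts : ∀ {n m} (σ : Fin n → Term L m) R ts →
                       unfoldAtom R (tsubsts σ ts) ≡ fsubst σ (unfoldAtom R ts)
  unfoldAtom-tsubsts σ (inj₁ R) ts = refl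
  unfoldAtom-tsubsts σ (inj₂ (true , k , A)) ts =
    sym (fsubst-∘ (λ i → sym (lookup-tsubsts σ ts i)) A)
  unfoldAtom-tsubsts σ (inj₂ (false , k , A)) ts =
    cong ¬ᶠ_ (sym (fsubst-∘ (λ i → sym (lookup-tsubsts σ ts i)) A))

  open Relabel {Fun L} {fari L} {Rel (LA L)} {Rel L} {rari (LA L)} {rari L}
               unfoldAtom unfoldAtom-tsubsts public
    renaming ( translate to unfold ; translate-close to unfold-close
             ; translate-wk₀ to unfold-wk₀ ; translate-deriv to unfold-deriv )

  unfold-ι : ∀ {n} (A : Formula L n) → unfold (ι A) ≡ A
  unfold-ι (atom R ts) = refl
  unfold-ι (A ∧ᶠ B)    = cong₂ _∧ᶠ_ (unfold-ι A) (unfold-ι B)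
  unfold-ι (A ∨ᶠ B)    = cong₂ _∨ᶠ_ (unfold-ι A) (unfold-ι B)
  unfold-ι (A ⇒ᶠ B)    = cong₂ _⇒ᶠ_ (unfold-ι A) (unfold-ι B)
  unfold-ι (¬ᶠ A)      = cong ¬ᶠ_ (unfold-ι A)
  unfold-ι (∃ᶠ A)      = cong ∃ᶠ (unfold-ι A)
  unfold-ι (∀ᶠ A)      = cong ∀ᶠ (unfold-ι A)

  unfold-Pᶠ : ∀ {n} (A : Formula L n) → unfold (Pᶠ A) ≡ A
  unfold-Pᶠ {n} A = fsubst-var (lookup∘tabulate var) A

  unfold-Nᶠ : ∀ {n} (A : Formula L n) → unfold (Nᶠ A) ≡ ¬ᶠ A
  unfold-Nᶠ A = cong ¬ᶠ_ (unfold-Pᶠ A)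

module ClassicalEquivalence {L : Language} {Ax : Sentence L → Set} where
  open Derivations {L} {classical} {Ax}

  infix 3 _≅_
  _≅_ : ∀ {k} → Formula L k → Formula L k → Set
  X ≅ Y = Derivable (X ⇒ᶠ Y) × Derivable (Y ⇒ᶠ X)

  ≡⇒≅ : ∀ {k} {X Y : Formula L k} → X ≡ Y → X ≅ Y
  ≡⇒≅ refl = (λ Γ σ → ⇒I hyp₀) , (λ Γ σ → ⇒I hyp₀)

  ⇒≅¬∨ : ∀ {k} (X Y : Formula L k) → (X ⇒ᶠ Y) ≅ (¬ᶠ X ∨ᶠ Y)
  ⇒≅¬∨ X Y = (λ Γ σ → ⇒I (∨E (lem refl) (∨I₂ (⇒E hyp₁ hyp₀)) (∨I₁ hyp₀)))
           , (λ Γ σ → ⇒I (⇒I (∨E hyp₁ (¬E hyp₁ hyp₀) hyp₀)))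

  ¬∀⇒∃¬ : ∀ {n} {Γ : List (Formula L n)} (Y : Formula L (suc n)) →
          Deriv classical Ax Γ (¬ᶠ ∀ᶠ Y ⇒ᶠ ∃ᶠ (¬ᶠ Y))
  ¬∀⇒∃¬ Y = ⇒I (∨E (lem refl) hyp₀
    (¬E (∀I (∨E (lem refl) hyp₀
          (¬E (∃I (var zero)
                  (subst (Deriv classical Ax _) (cong ¬ᶠ_ (sym (inst-lift-shift Y))) hyp₀))
              hyp₁)))
        hyp₁))

  ∃¬⇒¬∀ : ∀ {n} {Γ : List (Formula L n)} (Y : Formula L (suc n)) →
          Deriv classical Ax Γ (∃ᶠ (¬ᶠ Y) ⇒ᶠ ¬ᶠ ∀ᶠ Y)
  ∃¬⇒¬∀ Y = ⇒I (¬I hyp₀ (∃E hyp₁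
    (¬E (subst (Deriv classical Ax _) (inst-lift-shift Y) (∀E hyp₁ (var zero))) hyp₀)))

  ¬∀≅∃¬ : ∀ {k} (Y : Formula L (suc k)) → ¬ᶠ ∀ᶠ Y ≅ ∃ᶠ (¬ᶠ Y)
  ¬∀≅∃¬ Y = (λ Γ σ → ¬∀⇒∃¬ (fsubst (lift {L} σ) Y))
          , (λ Γ σ → ∃¬⇒¬∀ (fsubst (lift {L} σ) Y))

module Extension {L : Language} {lg : Logic} (T : Theory L) where
  open Derivations {LA L} {lg} {TaAx T}
  open Pᶠ-Equivalence {L} {lg} {TaAx T} ma
  open Embedding L

  ι-axiom : ∀ {φ} → TAx T φ →
            ∀ {n} (Γ : List (Formula (LA L) n)) → Deriv lg (TaAx T) Γ (wk₀ n (translate φ))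
  ι-axiom (tax {A = A} t) {n} Γ =
    subst (Deriv lg (TaAx T) Γ)
          (cong (wk₀ n) (trans (cong close (ι-translate A)) (sym (translate-close A))))
          (close-intro (λ Δ σ → ⇒E (Pᶠ⇒ι A Δ σ) (axiom-derivable (tpa t) Δ σ)) Γ)

  Ta-extends-T : ∀ {B} → TAx T ⊢⟨ lg ⟩ B → TaAx T ⊢⟨ lg ⟩ ι B
  Ta-extends-T {B} (m , d) =
    m , subst (Deriv lg (TaAx T) [])
              (trans (translate-wk₀ m B) (cong (wk₀ m) (sym (ι-translate B))))
              (translate-deriv ι-axiom d)

module Restriction {L : Language} (T : Theory L) where
  open Derivations {L} {classical} {TAx T}
  open ClassicalEquivalence {L} {TAx T}
  open Unfolding L

  unfold-bicond : ∀ {k} {φ ψ : Formula (LA L) k} → MaBicond φ ψ → unfold φ ≅ unfold ψ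
  unfold-bicond (c-atom R ts) = ≡⇒≅ (unfold-Pᶠ (atom R ts))
  unfold-bicond (c-and B C)   = ≡⇒≅ refl
  unfold-bicond (c-or B C)    = ≡⇒≅ refl
  unfold-bicond (c-not B)     = ≡⇒≅ refl
  unfold-bicond (c-imp B C)   = ⇒≅¬∨ _ _
  unfold-bicond (c-ex B)      =
    ≡⇒≅ (trans (unfold-Pᶠ (∃ᶠ B)) (cong ∃ᶠ (sym (unfold-Pᶠ B))))
  unfold-bicond (c-all B)     =
    subst₂ _≅_ (sym (unfold-Nᶠ (∀ᶠ B))) (cong ∃ᶠ (sym (unfold-Nᶠ B))) (¬∀≅∃¬ B)

  unfold-closed : ∀ {k} (χ : Formula (LA L) k) → Derivable (unfold χ) →
                  ∀ {n} (Γ : List (Formula L n)) →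
                  Deriv classical (TAx T) Γ (wk₀ n (unfold (close χ)))
  unfold-closed χ H {n} Γ =
    subst (Deriv classical (TAx T) Γ) (cong (wk₀ n) (sym (unfold-close χ))) (close-intro H Γ)

  unfold-axiom : ∀ {φ} → TaAx T φ →
                 ∀ {n} (Γ : List (Formula L n)) → Deriv classical (TAx T) Γ (wk₀ n (unfold φ))
  unfold-axiom (tpa {A = A} t) =
    unfold-closed (Pᶠ A) (subst Derivable (sym (unfold-Pᶠ A)) (axiom-derivable (tax t)))
  unfold-axiom (ma (excl A)) =
    unfold-closed (¬ᶠ (Pᶠ A ∧ᶠ Nᶠ A)) (λ Γ σ → ¬I (∧E₁ hyp₀) (∧E₂ hyp₀))
  unfold-axiom (ma (total A)) =
    unfold-closed (Pᶠ A ∨ᶠ Nᶠ A) (λ Γ σ → lem refl)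
  unfold-axiom (ma (fwd {φ = φ} {ψ} b)) =
    unfold-closed (φ ⇒ᶠ ψ) (proj₁ (unfold-bicond b))
  unfold-axiom (ma (bwd {φ = φ} {ψ} b)) =
    unfold-closed (ψ ⇒ᶠ φ) (proj₂ (unfold-bicond b))

  Ta-conservative : ∀ {B} → TaAx T ⊢⟨ classical ⟩ ι B → TAx T ⊢⟨ classical ⟩ B
  Ta-conservative {B} (m , d) =
    m , subst (Deriv classical (TAx T) [])
              (trans (unfold-wk₀ m (ι B)) (cong (wk₀ m) (unfold-ι B)))
              (unfold-deriv unfold-axiom d)

Ma-proves-Pᶠ-iff : ∀ {L : Language} {lg : Logic} {n} (A : Formula L n) →
                   MaAx ⊢⟨ lg ⟩ close ((ι A ⇒ᶠ Pᶠ A) ∧ᶠ (Pᶠ A ⇒ᶠ ι A))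
Ma-proves-Pᶠ-iff A = 0 , close-intro (λ Γ σ → ∧I (ι⇒Pᶠ A Γ σ) (Pᶠ⇒ι A Γ σ)) []
  where
  open Derivations
  open Pᶠ-Equivalence (λ a → a)

lemma3p2 : (L : Language) →
    ((n : ℕ) (A : Formula L n) →
      MaAx ⊢⟨ intuitionistic ⟩ close ((ι A ⇒ᶠ Pᶠ A) ∧ᶠ (Pᶠ A ⇒ᶠ ι A)))
    × ((T : Theory L) (B : Sentence L) →
      (TAx T ⊢⟨ classical ⟩ B) ⇔ (TaAx T ⊢⟨ classical ⟩ ι B))
lemma3p2 L = (λ n → Ma-proves-Pᶠ-iff)
           , (λ T B → mk⇔ (Extension.Ta-extends-T T) (Restriction.Ta-conservative T))
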